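{- Let $\Gamma$ be a graph arising as an oriented graph square. If $v \in V(\Gamma)$ is a cut vertex of $\Gamma$, then $v$ is a source or a sink in every oriented graph $\overrightarrow{G}$ such that $\Gamma = U(\overrightarrow{G}^2)$.
   Context: An oriented graph is obtained from a simple graph by orienting each edge as an arc. For an oriented graph $\overrightarrow{G}$, $\overrightarrow{G}^2$ is the mixed graph obtained from $\overrightarrow{G}$ by adding an undirected edge between every pair of vertices at directed distance two, and $U(\cdot)$ denotes the underlying simple graph. $\Gamma$ is an oriented graph square if $\Gamma = U(\overrightarrow{G}^2)$ for some oriented graph $\overrightarrow{G}$. A vertex $v$ is a source (resp. sink) of an oriented graph if all arcs incident with $v$ have their tail (resp. head) at $v$. -}

module Defs where

open import Data.Nat using (ℕ)
open import Data.Fin using (Fin)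
open import Data.Product using (_×_; ∃-syntax; Σ-syntax)
open import Data.Sum using (_⊎_)
open import Relation.Nullary using (¬_)
open import Relation.Binary.PropositionalEquality using (_≡_; _≢_)
open import Function.Bundles using (_⇔_)
open import Data.Unit using (⊤)

record SimpleGraph (n : ℕ) : Set₁ where
  field
    Adj     : Fin n → Fin n → Set
    sym     : ∀ {u w} → Adj u w → Adj w u
    irrefl  : ∀ {u} → ¬ Adj u u

record OrientedGraph (n : ℕ) : Set₁ where
  field
    Arc      : Fin n → Fin n → Set
    irrefl   : ∀ {u} → ¬ Arc u u
    antisym  : ∀ {u w} → Arc u w → ¬ Arc w u

open SimpleGraph public
open OrientedGraph public

-- Adjacency in U(G²): distinct vertices joined by an arc (either direction)
-- or at directed distance two (in either direction).
SqAdj : ∀ {n} → OrientedGraph n → Fin n → Fin n → Set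
SqAdj G u w =
  (u ≢ w) ×
  (Arc G u w ⊎ Arc G w u ⊎
   (∃[ x ] (Arc G u x × Arc G x w)) ⊎ (∃[ x ] (Arc G w x × Arc G x u)))

IsSquareOf : ∀ {n} → SimpleGraph n → OrientedGraph n → Set
IsSquareOf Γ G = ∀ u w → Adj Γ u w ⇔ SqAdj G u w

data WalkIn {n} (Γ : SimpleGraph n) (P : Fin n → Set) : Fin n → Fin n → Set where
  here  : ∀ {u} → P u → WalkIn Γ P u u
  step  : ∀ {u x w} → P u → Adj Γ u x → WalkIn Γ P x w → WalkIn Γ P u w

Connected : ∀ {n} → SimpleGraph n → Fin n → Fin n → Set
Connected Γ u w = WalkIn Γ (λ _ → ⊤) u w

ConnectedAvoiding : ∀ {n} → SimpleGraph n → Fin n → Fin n → Fin n → Set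
ConnectedAvoiding Γ v u w = WalkIn Γ (λ x → x ≢ v) u w

-- v is a cut vertex: it separates two vertices of the same component
-- (equivalently, Γ - v has more components than Γ).
IsCutVertex : ∀ {n} → SimpleGraph n → Fin n → Set
IsCutVertex Γ v =
  ∃[ u ] ∃[ w ] (u ≢ v × w ≢ v × Connected Γ u w × ¬ ConnectedAvoiding Γ v u w)

IsSource : ∀ {n} → OrientedGraph n → Fin n → Set
IsSource G v = ∀ u → ¬ Arc G u v

IsSink : ∀ {n} → OrientedGraph n → Fin n → Set
IsSink G v = ∀ u → ¬ Arc G v u

-- If v had both an in-neighbour a and an out-neighbour b in G, then a and b,
-- and more generally every Γ-neighbour of v and b, would be joined through
-- distance-two adjacencies that bypass v.  So every walk through v could be
-- rerouted around v, and v would not be a cut vertex.  A cut vertex has some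
-- Γ-neighbour, hence an incident arc, so all its arcs point the same way.
module Submission where

open import Defs
open import Data.Nat using (ℕ)
open import Data.Fin using (Fin; _≟_)
open import Data.Sum using (_⊎_; inj₁; inj₂)
open import Data.Product using (_×_; _,_; ∃-syntax)
open import Relation.Nullary using (¬_; yes; no; contradiction)
open import Relation.Binary.PropositionalEquality using (_≢_; refl; ≢-sym)
open import Function.Bundles using (Equivalence)

module _ {n : ℕ} {Γ : SimpleGraph n} {P : Fin n → Set} where

  walk-++ : ∀ {x y z} → WalkIn Γ P x y → WalkIn Γ P y z → WalkIn Γ P x z
  walk-++ (here _)     q = q
  walk-++ (step p e r) q = step p e (walk-++ r q)

  walk-snoc : ∀ {x y z} → WalkIn Γ P x y → Adj Γ y z → P z → WalkIn Γ P x z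
  walk-snoc (here p)     e pz = step p e (here pz)
  walk-snoc (step p e r) f pz = step p e (walk-snoc r f pz)

  walk-reverse : ∀ {x y} → WalkIn Γ P x y → WalkIn Γ P y x
  walk-reverse (here p)     = here p
  walk-reverse (step p e r) = walk-snoc (walk-reverse r) (SimpleGraph.sym Γ e) p

module _ {n : ℕ} {Γ : SimpleGraph n} {v : Fin n} where

  avoids-or-reaches-neighbour : ∀ {x w} → x ≢ v → Connected Γ x w →
    ConnectedAvoiding Γ v x w ⊎ ∃[ y ] (ConnectedAvoiding Γ v x y × Adj Γ y v)
  avoids-or-reaches-neighbour x≢v (here _) = inj₁ (here x≢v)
  avoids-or-reaches-neighbour x≢v (step {x = y} _ e r) with y ≟ v
  ... | yes refl = inj₂ (_ , here x≢v , e)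
  ... | no y≢v with avoids-or-reaches-neighbour y≢v r
  ...   | inj₁ c            = inj₁ (step x≢v e c)
  ...   | inj₂ (z , c , f)  = inj₂ (z , step x≢v e c , f)

  neighbours-reach-hub⇒connected-avoiding : ∀ {b} →
    (∀ {x} → x ≢ v → Adj Γ x v → ConnectedAvoiding Γ v x b) →
    ∀ {u w} → u ≢ v → w ≢ v → Connected Γ u w → ConnectedAvoiding Γ v u w
  neighbours-reach-hub⇒connected-avoiding hub u≢v w≢v c
    with avoids-or-reaches-neighbour u≢v c
  ... | inj₁ d = d
  ... | inj₂ (y , u⇝y , yv) with avoids-or-reaches-neighbour w≢v (walk-reverse c)
  ...   | inj₁ d = walk-reverse d
  ...   | inj₂ (z , w⇝z , zv) =
          walk-++ (walk-++ u⇝y (hub (end≢ u⇝y) yv))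
                  (walk-reverse (walk-++ w⇝z (hub (end≢ w⇝z) zv)))
    where
      end≢ : ∀ {x y} → ConnectedAvoiding Γ v x y → y ≢ v
      end≢ (here p)     = p
      end≢ (step _ _ r) = end≢ r

module _ {n : ℕ} {Γ : SimpleGraph n} {G : OrientedGraph n} (sq : IsSquareOf Γ G) where

  arc⇒≢ : ∀ {x y} → Arc G x y → x ≢ y
  arc⇒≢ xy refl = OrientedGraph.irrefl G xy

  arc⇒adj : ∀ {x y} → Arc G x y → Adj Γ x y
  arc⇒adj {x} {y} xy = Equivalence.from (sq x y) (arc⇒≢ xy , inj₁ xy)

  dipath⇒adj : ∀ {x y z} → Arc G x y → Arc G y z → Adj Γ x z
  dipath⇒adj {x} {y} {z} xy yz =
    Equivalence.from (sq x z) (x≢z , inj₂ (inj₂ (inj₁ (y , xy , yz))))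
    where
      x≢z : x ≢ z
      x≢z refl = OrientedGraph.antisym G xy yz

  neighbour-incident-arc : ∀ {x v} → Adj Γ x v → (∃[ a ] Arc G a v) ⊎ (∃[ b ] Arc G v b)
  neighbour-incident-arc {x} {v} e with Equivalence.to (sq x v) e
  ... | _ , inj₁ xv                          = inj₁ (x , xv)
  ... | _ , inj₂ (inj₁ vx)                   = inj₂ (x , vx)
  ... | _ , inj₂ (inj₂ (inj₁ (y , _ , yv)))  = inj₁ (y , yv)
  ... | _ , inj₂ (inj₂ (inj₂ (y , vy , _)))  = inj₂ (y , vy)

  module _ {a v b : Fin n} (av : Arc G a v) (vb : Arc G v b) where

    b≢v : b ≢ v
    b≢v = ≢-sym (arc⇒≢ vb)

    a⇝b : ConnectedAvoiding Γ v a b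
    a⇝b = step (arc⇒≢ av) (dipath⇒adj av vb) (here b≢v)

    neighbour-reaches-out-neighbour : ∀ {x} → x ≢ v → Adj Γ x v → ConnectedAvoiding Γ v x b
    neighbour-reaches-out-neighbour {x} x≢v e with Equivalence.to (sq x v) e
    ... | _ , inj₁ xv =
          step x≢v (dipath⇒adj xv vb) (here b≢v)
    ... | _ , inj₂ (inj₁ vx) =
          step x≢v (SimpleGraph.sym Γ (dipath⇒adj av vx)) a⇝b
    ... | _ , inj₂ (inj₂ (inj₁ (y , xy , yv))) =
          step x≢v (arc⇒adj xy) (step (arc⇒≢ yv) (dipath⇒adj yv vb) (here b≢v))
    ... | _ , inj₂ (inj₂ (inj₂ (y , vy , yx))) =
          step x≢v (SimpleGraph.sym Γ (arc⇒adj yx))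
            (step (≢-sym (arc⇒≢ vy)) (SimpleGraph.sym Γ (dipath⇒adj av vy)) a⇝b)

    in-and-out-arc⇒¬cut-vertex : ¬ IsCutVertex Γ v
    in-and-out-arc⇒¬cut-vertex (u , w , u≢v , w≢v , u⇝w , ¬u⇝w) =
      ¬u⇝w (neighbours-reach-hub⇒connected-avoiding
              neighbour-reaches-out-neighbour u≢v w≢v u⇝w)

  cut-vertex-incident-arc : ∀ {v} → IsCutVertex Γ v →
    (∃[ a ] Arc G a v) ⊎ (∃[ b ] Arc G v b)
  cut-vertex-incident-arc (u , w , u≢v , _ , u⇝w , ¬u⇝w)
    with avoids-or-reaches-neighbour u≢v u⇝w
  ... | inj₁ d             = contradiction d ¬u⇝w
  ... | inj₂ (_ , _ , yv)  = neighbour-incident-arc yv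

theorem2p5 : (n : ℕ) (Γ : SimpleGraph n) (G₀ : OrientedGraph n) →
    IsSquareOf Γ G₀ → (v : Fin n) → IsCutVertex Γ v →
    (G : OrientedGraph n) → IsSquareOf Γ G → IsSource G v ⊎ IsSink G v
theorem2p5 n Γ G₀ _ v cut G sq with cut-vertex-incident-arc {Γ = Γ} {G = G} sq cut
... | inj₁ (a , av) = inj₂ λ b vb → in-and-out-arc⇒¬cut-vertex {Γ = Γ} {G = G} sq av vb cut
... | inj₂ (b , vb) = inj₁ λ a av → in-and-out-arc⇒¬cut-vertex {Γ = Γ} {G = G} sq av vb cut
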